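{- Let $\overline\Gamma$ be a subgroup of finite index of $\mathrm{PSL}_2(\mathbb Z)$ with a presentation by generators $\bar g_1,\dots,\bar g_s$ and relations $\bar R_1=1,\dots,\bar R_t=1$, where each relation has the form $\bar R_j=\prod_{k=1}^{m_j}\bar h_{j,k}$ with each $\bar h_{j,k}\in\{\bar g_1,\dots,\bar g_s\}$. For $i=1,\dots,s$ and $j=1,\dots,t$ let $\sigma_{i,j}$ be the number of $k\in\{1,\dots,m_j\}$ with $\bar h_{j,k}=\bar g_i$. (i) $\overline\Gamma$ has a lift $\Gamma\le\mathrm{SL}_2(\mathbb Z)$ with $-1\notin\Gamma$ if and only if there are lifts $g_i\in\mathrm{SL}_2(\mathbb Z)$ of the $\bar g_i$ such that $R_j=1$ for all $j=1,\dots,t$, where $R_j:=\prod_{k=1}^{m_j}h_{j,k}$ with $h_{j,k}:=g_i$ whenever $\bar h_{j,k}=\bar g_i$. (ii) Suppose $\overline\Gamma$ has a lift $\Gamma$ with $-1\notin\Gamma$, generated by lifts $g_1,\dots,g_s$ as in (i). Then the lifts of $\overline\Gamma$ not containing $-1$ are in bijection with the solutions $(x_1,\dots,x_s)\in\mathbb F_2^s$ of the linear system $\sum_{i=1}^s x_i\,(\sigma_{i,j}\bmod 2)=0$ for $j=1,\dots,t$ over $\mathbb F_2$; a solution $X=(x_1,\dots,x_s)$ corresponds to the subgroup $\Gamma_X$ of $\mathrm{SL}_2(\mathbb Z)$ generated by $\{g_i: x_i=0\}\cup\{ -g_i: x_i=1\}$.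
   Context: A lift of a subgroup $\overline\Gamma\le\mathrm{PSL}_2(\mathbb Z)$ is a subgroup of $\mathrm{SL}_2(\mathbb Z)$ whose image under the canonical map $\mathrm{SL}_2(\mathbb Z)\to\mathrm{PSL}_2(\mathbb Z)$ equals $\overline\Gamma$. A lift of an element $\bar g\in\mathrm{PSL}_2(\mathbb Z)$ is one of its two preimages in $\mathrm{SL}_2(\mathbb Z)$. -}

module Defs where

open import Data.Nat using (ℕ; zero; suc)
open import Data.Integer using (ℤ; _+_; _*_; _-_; -_; 0ℤ; 1ℤ)
open import Data.Fin using (Fin; zero; suc; _≟_)
open import Data.Bool using (Bool; true; false; _xor_; _∧_; not; if_then_else_)
open import Data.List using (List; []; _∷_; _++_; map; length; filter)
open import Data.Vec using (Vec; lookup)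
open import Data.Product using (Σ; ∃; _×_; _,_)
open import Data.Sum using (_⊎_)
open import Relation.Nullary using (¬_)
open import Relation.Binary.PropositionalEquality using (_≡_)

record M2 : Set where
  constructor mat
  field
    a b c d : ℤ

infixl 7 _·_
_·_ : M2 → M2 → M2
mat a b c d · mat a' b' c' d' =
  mat (a * a' + b * c') (a * b' + b * d') (c * a' + d * c') (c * b' + d * d')

I : M2
I = mat 1ℤ 0ℤ 0ℤ 1ℤ

neg : M2 → M2
neg (mat a b c d) = mat (- a) (- b) (- c) (- d)

det : M2 → ℤ
det (mat a b c d) = a * d - b * c

-- adjugate; the inverse of a matrix of determinant 1
inv : M2 → M2
inv (mat a b c d) = mat d (- b) (- c) a

IsSL2 : M2 → Set
IsSL2 g = det g ≡ 1ℤ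

record IsSubgroupSL2 (H : M2 → Set) : Set where
  field
    inSL  : ∀ g → H g → IsSL2 g
    one   : H I
    mul   : ∀ g h → H g → H h → H (g · h)
    invH  : ∀ g → H g → H (inv g)

-- PSL₂(ℤ) = SL₂(ℤ)/{±1}: elements are represented by matrices in SL₂(ℤ),
-- two representatives being equal iff they agree up to sign.

_≈P_ : M2 → M2 → Set
g ≈P h = (g ≡ h) ⊎ (g ≡ neg h)

record IsSubgroupPSL2 (H : M2 → Set) : Set where
  field
    inSL   : ∀ g → H g → IsSL2 g
    resp   : ∀ g h → g ≈P h → H g → H h
    one    : H I
    mul    : ∀ g h → H g → H h → H (g · h)
    invH   : ∀ g → H g → H (inv g)

FiniteIndex : (M2 → Set) → Set
FiniteIndex H = Σ ℕ λ n → Σ (Fin n → M2) λ c →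
  (∀ k → IsSL2 (c k)) × (∀ g → IsSL2 g → ∃ λ k → H (inv (c k) · g))

-- Words in the free group on s generators: a letter (i , false) is x_i,
-- a letter (i , true) is x_i⁻¹.

Letter : ℕ → Set
Letter s = Fin s × Bool

FWord : ℕ → Set
FWord s = List (Letter s)

pos : ∀ {s} → List (Fin s) → FWord s
pos = map (λ i → i , false)

evalW : ∀ {s} → (Fin s → M2) → FWord s → M2
evalW g [] = I
evalW g ((i , false) ∷ w) = g i · evalW g w
evalW g ((i , true)  ∷ w) = inv (g i) · evalW g w

evalPos : ∀ {s} → (Fin s → M2) → List (Fin s) → M2
evalPos g w = evalW g (pos w)

data Step {s t : ℕ} (rel : Fin t → List (Fin s)) : FWord s → FWord s → Set where
  cancel : ∀ l r i b → Step rel (l ++ (i , b) ∷ (i , not b) ∷ r) (l ++ r)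
  relator : ∀ l r j → Step rel (l ++ pos (rel j) ++ r) (l ++ r)

-- equality in the finitely presented group ⟨ x_1..x_s | R_1..R_t ⟩
data _∼⟨_⟩_ {s t : ℕ} : FWord s → (Fin t → List (Fin s)) → FWord s → Set where
  refl∼ : ∀ {rel w} → w ∼⟨ rel ⟩ w
  fwd   : ∀ {rel u v w} → Step rel u v → v ∼⟨ rel ⟩ w → u ∼⟨ rel ⟩ w
  bwd   : ∀ {rel u v w} → Step rel v u → v ∼⟨ rel ⟩ w → u ∼⟨ rel ⟩ w

-- H ≤ PSL₂(ℤ) has the presentation with generators ḡ_i and relations
-- R̄_j = ∏_k ḡ_{rel j k} = 1, i.e. the map x_i ↦ ḡ_i induces an isomorphism
-- ⟨ x_1..x_s | R_1..R_t ⟩ ≅ H.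
record IsPresentation {s t : ℕ} (H : M2 → Set) (gbar : Fin s → M2)
                      (rel : Fin t → List (Fin s)) : Set where
  field
    genIn    : ∀ i → H (gbar i)
    relHolds : ∀ j → evalPos gbar (rel j) ≈P I
    surj     : ∀ h → H h → ∃ λ w → evalW gbar w ≈P h
    kernel   : ∀ w → evalW gbar w ≈P I → w ∼⟨ rel ⟩ []

IsLift : (M2 → Set) → (M2 → Set) → Set
IsLift Γ H = IsSubgroupSL2 Γ × (∀ g → Γ g → H g) × (∀ g → H g → Γ g ⊎ Γ (neg g))

data Generated {s : ℕ} (g : Fin s → M2) : M2 → Set where
  gen  : ∀ i → Generated g (g i)
  one  : Generated g I
  mul  : ∀ {x y} → Generated g x → Generated g y → Generated g (x · y)
  invG : ∀ {x} → Generated g x → Generated g (inv x)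

-- The linear system over 𝔽₂ (𝔽₂ = Bool, + = xor, · = ∧)

σ : ∀ {s} → Fin s → List (Fin s) → ℕ
σ i w = length (filter (_≟ i) w)

mod2 : ℕ → Bool
mod2 zero = false
mod2 (suc n) = not (mod2 n)

sumF2 : ∀ {s} → (Fin s → Bool) → Bool
sumF2 {zero} f = false
sumF2 {suc s} f = f zero xor sumF2 (λ i → f (suc i))

IsSolution : ∀ {s t} → (Fin t → List (Fin s)) → Vec Bool s → Set
IsSolution {s} {t} rel x =
  ∀ (j : Fin t) → sumF2 (λ i → lookup x i ∧ mod2 (σ i (rel j))) ≡ false

ΓX : ∀ {s} → (Fin s → M2) → Vec Bool s → M2 → Set
ΓX g x = Generated (λ i → if lookup x i then neg (g i) else g i)

_≐_ : (M2 → Set) → (M2 → Set) → Set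
A ≐ B = ∀ h → (A h → B h) × (B h → A h)

{-# OPTIONS --safe #-}
-- Let ḡ ↦ g be lifts of the generators that satisfy every relation exactly in
-- SL₂(ℤ).  Then every word in the gᵢ that is trivial in PSL₂(ℤ) is a
-- consequence of the relations, hence equals I in SL₂(ℤ); so ⟨g⟩ avoids −1
-- and, being a subgroup mapping onto Γ̄, it is a lift.  Conversely a lift Γ
-- avoiding −1 contains one sign of each ḡᵢ, and a relator evaluated at these
-- signs lies in Γ and is ±1, hence 1.  Changing the signs by x ∈ 𝔽₂ˢ multiplies
-- the j-th relator by (−1)^(Σᵢ xᵢ σᵢⱼ), so the admissible sign changes are
-- exactly the solutions of the system; distinct solutions give distinct
-- groups, since a group avoiding −1 cannot contain both gᵢ and −gᵢ, and a lift
-- avoiding −1 cannot properly contain another.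
module Submission where

open import Defs
open import Algebra.Bundles using (CommutativeRing)
open import Data.Bool using (Bool; true; false; _xor_; _∧_; not; if_then_else_)
open import Data.Bool.Properties
  using (∧-distribˡ-xor; ∧-zeroʳ; ∧-identityʳ; xor-identityʳ; xor-∧-commutativeRing) renaming (_≟_ to _≟ᵇ_)
open import Data.Empty using (⊥-elim)
open import Data.Fin using (Fin; zero; suc; _≟_)
open import Data.Integer using (ℤ; _+_; _*_; _-_; -_; 0ℤ; 1ℤ)
open import Data.Integer.Tactic.RingSolver using (solve-∀)
open import Data.List using (List; []; _∷_; _++_)
open import Data.Nat using (ℕ; zero; suc)
open import Data.Product using (Σ; ∃; _×_; _,_; proj₁; proj₂)
open import Data.Sum using (_⊎_; inj₁; inj₂)
open import Data.Vec using (Vec; lookup; tabulate; _∷_)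
open import Data.Vec.Properties using (lookup∘tabulate; tabulate∘lookup; tabulate-cong)
open import Relation.Nullary using (¬_; does; yes; no)
open import Relation.Binary.PropositionalEquality
open import Algebra.Properties.CommutativeSemigroup
  (CommutativeRing.+-commutativeSemigroup xor-∧-commutativeRing) using (interchange)

mat-cong : ∀ {a b c d a′ b′ c′ d′} → a ≡ a′ → b ≡ b′ → c ≡ c′ → d ≡ d′ →
           mat a b c d ≡ mat a′ b′ c′ d′
mat-cong refl refl refl refl = refl

·-assoc : ∀ x y z → (x · y) · z ≡ x · (y · z)
·-assoc (mat a b c d) (mat e f g h) (mat i j k l) =
  mat-cong (entry a b e f g h i k) (entry a b e f g h j l) (entry c d e f g h i k) (entry c d e f g h j l)
  where
  entry : ∀ a b e f g h i k → (a * e + b * g) * i + (a * f + b * h) * k ≡ a * (e * i + f * k) + b * (g * i + h * k)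
  entry = solve-∀

·-identityˡ : ∀ x → I · x ≡ x
·-identityˡ (mat a b c d) = mat-cong (entry₁ a c) (entry₁ b d) (entry₂ a c) (entry₂ b d)
  where
  entry₁ : ∀ a c → 1ℤ * a + 0ℤ * c ≡ a
  entry₁ = solve-∀
  entry₂ : ∀ a c → 0ℤ * a + 1ℤ * c ≡ c
  entry₂ = solve-∀

·-identityʳ : ∀ x → x · I ≡ x
·-identityʳ (mat a b c d) = mat-cong (entry₁ a b) (entry₂ a b) (entry₁ c d) (entry₂ c d)
  where
  entry₁ : ∀ a b → a * 1ℤ + b * 0ℤ ≡ a
  entry₁ = solve-∀
  entry₂ : ∀ a b → a * 0ℤ + b * 1ℤ ≡ b
  entry₂ = solve-∀

-‿involutive : ∀ (a : ℤ) → - (- a) ≡ a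
-‿involutive = solve-∀

neg-involutive : ∀ x → neg (neg x) ≡ x
neg-involutive (mat a b c d) = mat-cong (-‿involutive a) (-‿involutive b) (-‿involutive c) (-‿involutive d)

neg-distribˡ-· : ∀ x y → neg x · y ≡ neg (x · y)
neg-distribˡ-· (mat a b c d) (mat e f g h) = mat-cong (entry a b e g) (entry a b f h) (entry c d e g) (entry c d f h)
  where
  entry : ∀ a b e g → (- a) * e + (- b) * g ≡ - (a * e + b * g)
  entry = solve-∀

neg-distribʳ-· : ∀ x y → x · neg y ≡ neg (x · y)
neg-distribʳ-· (mat a b c d) (mat e f g h) = mat-cong (entry a b e g) (entry a b f h) (entry c d e g) (entry c d f h)
  where
  entry : ∀ a b e g → a * (- e) + b * (- g) ≡ - (a * e + b * g)
  entry = solve-∀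

neg-·-neg : ∀ x y → neg x · neg y ≡ x · y
neg-·-neg x y = begin
  neg x · neg y     ≡⟨ neg-distribˡ-· x (neg y) ⟩
  neg (x · neg y)   ≡⟨ cong neg (neg-distribʳ-· x y) ⟩
  neg (neg (x · y)) ≡⟨ neg-involutive (x · y) ⟩
  x · y             ∎
  where open ≡-Reasoning

inv-neg : ∀ x → inv (neg x) ≡ neg (inv x)
inv-neg (mat a b c d) = refl

inv-involutive : ∀ x → inv (inv x) ≡ x
inv-involutive (mat a b c d) = mat-cong refl (-‿involutive b) (-‿involutive c) refl

inv-anti-· : ∀ x y → inv (x · y) ≡ inv y · inv x
inv-anti-· (mat a b c d) (mat e f g h) = mat-cong (entry₁ c d f h) (entry₂ a b f h) (entry₃ c d e g) (entry₄ a b e g)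
  where
  entry₁ : ∀ c d f h → c * f + d * h ≡ h * d + (- f) * (- c)
  entry₁ = solve-∀
  entry₂ : ∀ a b f h → - (a * f + b * h) ≡ h * (- b) + (- f) * a
  entry₂ = solve-∀
  entry₃ : ∀ c d e g → - (c * e + d * g) ≡ (- g) * d + e * (- c)
  entry₃ = solve-∀
  entry₄ : ∀ a b e g → a * e + b * g ≡ (- g) * (- b) + e * a
  entry₄ = solve-∀

inv-inverseˡ : ∀ x → IsSL2 x → inv x · x ≡ I
inv-inverseˡ (mat a b c d) det≡1 =
  mat-cong (trans (diag₁ a b c d) det≡1) (off b d) (off′ a c) (trans (diag₂ a b c d) det≡1)
  where
  diag₁ : ∀ a b c d → d * a + (- b) * c ≡ a * d - b * c
  diag₁ = solve-∀
  diag₂ : ∀ a b c d → (- c) * b + a * d ≡ a * d - b * c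
  diag₂ = solve-∀
  off : ∀ b d → d * b + (- b) * d ≡ 0ℤ
  off = solve-∀
  off′ : ∀ a c → (- c) * a + a * c ≡ 0ℤ
  off′ = solve-∀

det-inv : ∀ x → det (inv x) ≡ det x
det-inv (mat a b c d) = identity a b c d
  where
  identity : ∀ a b c d → d * a - (- b) * (- c) ≡ a * d - b * c
  identity = solve-∀

inv-inverseʳ : ∀ x → IsSL2 x → x · inv x ≡ I
inv-inverseʳ x det≡1 = begin
  x · inv x             ≡⟨ cong (_· inv x) (sym (inv-involutive x)) ⟩
  inv (inv x) · inv x   ≡⟨ inv-inverseˡ (inv x) (trans (det-inv x) det≡1) ⟩
  I                     ∎
  where open ≡-Reasoning

det-· : ∀ x y → det (x · y) ≡ det x * det y
det-· (mat a b c d) (mat e f g h) = identity a b c d e f g h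
  where
  identity : ∀ a b c d e f g h →
    (a * e + b * g) * (c * f + d * h) - (a * f + b * h) * (c * e + d * g) ≡ (a * d - b * c) * (e * h - f * g)
  identity = solve-∀

det-neg : ∀ x → det (neg x) ≡ det x
det-neg (mat a b c d) = identity a b c d
  where
  identity : ∀ a b c d → (- a) * (- d) - (- b) * (- c) ≡ a * d - b * c
  identity = solve-∀

I≢neg-I : I ≢ neg I
I≢neg-I ()

≈P-sym : ∀ {a b} → a ≈P b → b ≈P a
≈P-sym (inj₁ refl) = inj₁ refl
≈P-sym {b = b} (inj₂ refl) = inj₂ (sym (neg-involutive b))

≈P-trans : ∀ {a b c} → a ≈P b → b ≈P c → a ≈P c
≈P-trans (inj₁ refl) b≈c = b≈c
≈P-trans (inj₂ refl) (inj₁ refl) = inj₂ refl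
≈P-trans {c = c} (inj₂ refl) (inj₂ refl) = inj₁ (neg-involutive c)

·-cong-≈P : ∀ {a a′ b b′} → a ≈P a′ → b ≈P b′ → (a · b) ≈P (a′ · b′)
·-cong-≈P (inj₁ refl) (inj₁ refl) = inj₁ refl
·-cong-≈P {a} {b′ = b′} (inj₁ refl) (inj₂ refl) = inj₂ (neg-distribʳ-· a b′)
·-cong-≈P {a′ = a′} {b} (inj₂ refl) (inj₁ refl) = inj₂ (neg-distribˡ-· a′ b)
·-cong-≈P {a′ = a′} {b′ = b′} (inj₂ refl) (inj₂ refl) = inj₁ (neg-·-neg a′ b′)

inv-cong-≈P : ∀ {a b} → a ≈P b → inv a ≈P inv b
inv-cong-≈P (inj₁ refl) = inj₁ refl
inv-cong-≈P {b = b} (inj₂ refl) = inj₂ (inv-neg b)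

IsSL2-resp-≈P : ∀ {a b} → a ≈P b → IsSL2 b → IsSL2 a
IsSL2-resp-≈P (inj₁ refl) b∈SL = b∈SL
IsSL2-resp-≈P {b = b} (inj₂ refl) b∈SL = trans (det-neg b) b∈SL

±∈⇒neg-I∈ : ∀ {Γ} → IsSubgroupSL2 Γ → ∀ {a} → Γ a → Γ (neg a) → Γ (neg I)
±∈⇒neg-I∈ {Γ} Γ≤SL {a} a∈Γ -a∈Γ = subst Γ -a·a⁻¹≡-I (IsSubgroupSL2.mul Γ≤SL _ _ -a∈Γ (IsSubgroupSL2.invH Γ≤SL _ a∈Γ))
  where
  -a·a⁻¹≡-I : neg a · inv a ≡ neg I
  -a·a⁻¹≡-I = trans (neg-distribˡ-· a (inv a)) (cong neg (inv-inverseʳ a (IsSubgroupSL2.inSL Γ≤SL a a∈Γ)))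

≈P-I⇒≡I : ∀ {Γ : M2 → Set} {a} → ¬ Γ (neg I) → Γ a → a ≈P I → a ≡ I
≈P-I⇒≡I -I∉Γ a∈Γ (inj₁ a≡I) = a≡I
≈P-I⇒≡I -I∉Γ a∈Γ (inj₂ refl) = ⊥-elim (-I∉Γ a∈Γ)

-- Γ′ meets every coset {h, −h} that Γ meets, and Γ meets each such coset only once.
lift-⊆⇒≐ : ∀ {Γ Γ′ H : M2 → Set} → IsSubgroupSL2 Γ → ¬ Γ (neg I) → (∀ h → Γ h → H h) →
           (∀ h → H h → Γ′ h ⊎ Γ′ (neg h)) → (∀ h → Γ′ h → Γ h) → Γ ≐ Γ′
lift-⊆⇒≐ {Γ} {Γ′} Γ≤SL -I∉Γ Γ⊆H H⊆±Γ′ Γ′⊆Γ h = Γ⊆Γ′ , Γ′⊆Γ h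
  where
  Γ⊆Γ′ : Γ h → Γ′ h
  Γ⊆Γ′ h∈Γ with H⊆±Γ′ h (Γ⊆H h h∈Γ)
  ... | inj₁ h∈Γ′  = h∈Γ′
  ... | inj₂ -h∈Γ′ = ⊥-elim (-I∉Γ (±∈⇒neg-I∈ Γ≤SL h∈Γ (Γ′⊆Γ _ -h∈Γ′)))

module _ {s : ℕ} where

  evalW-++ : (g : Fin s → M2) (u v : FWord s) → evalW g (u ++ v) ≡ evalW g u · evalW g v
  evalW-++ g [] v = sym (·-identityˡ (evalW g v))
  evalW-++ g ((i , false) ∷ u) v =
    trans (cong (g i ·_) (evalW-++ g u v)) (sym (·-assoc (g i) (evalW g u) (evalW g v)))
  evalW-++ g ((i , true) ∷ u) v =
    trans (cong (inv (g i) ·_) (evalW-++ g u v)) (sym (·-assoc (inv (g i)) (evalW g u) (evalW g v)))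

  evalW-cong-≈P : {g g′ : Fin s → M2} → (∀ i → g i ≈P g′ i) → ∀ w → evalW g w ≈P evalW g′ w
  evalW-cong-≈P g≈g′ [] = inj₁ refl
  evalW-cong-≈P g≈g′ ((i , false) ∷ w) = ·-cong-≈P (g≈g′ i) (evalW-cong-≈P g≈g′ w)
  evalW-cong-≈P g≈g′ ((i , true) ∷ w) = ·-cong-≈P (inv-cong-≈P (g≈g′ i)) (evalW-cong-≈P g≈g′ w)

  invWord : FWord s → FWord s
  invWord [] = []
  invWord ((i , b) ∷ w) = invWord w ++ (i , not b) ∷ []

  evalW-invWord : (g : Fin s → M2) → ∀ w → evalW g (invWord w) ≡ inv (evalW g w)
  evalW-invWord g [] = refl
  evalW-invWord g ((i , false) ∷ w) = begin
    evalW g (invWord w ++ (i , true) ∷ [])  ≡⟨ evalW-++ g (invWord w) _ ⟩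
    evalW g (invWord w) · (inv (g i) · I)   ≡⟨ cong₂ _·_ (evalW-invWord g w) (·-identityʳ (inv (g i))) ⟩
    inv (evalW g w) · inv (g i)             ≡⟨ sym (inv-anti-· (g i) (evalW g w)) ⟩
    inv (g i · evalW g w)                   ∎
    where open ≡-Reasoning
  evalW-invWord g ((i , true) ∷ w) = begin
    evalW g (invWord w ++ (i , false) ∷ [])  ≡⟨ evalW-++ g (invWord w) _ ⟩
    evalW g (invWord w) · (g i · I)          ≡⟨ cong₂ _·_ (evalW-invWord g w) g-i≡inv-inv ⟩
    inv (evalW g w) · inv (inv (g i))        ≡⟨ sym (inv-anti-· (inv (g i)) (evalW g w)) ⟩
    inv (inv (g i) · evalW g w)              ∎
    where
    open ≡-Reasoning
    g-i≡inv-inv : g i · I ≡ inv (inv (g i))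
    g-i≡inv-inv = trans (·-identityʳ (g i)) (sym (inv-involutive (g i)))

  Generated⇒evalW : {g : Fin s → M2} {h : M2} → Generated g h → ∃ λ w → evalW g w ≡ h
  Generated⇒evalW {g} (gen i) = (i , false) ∷ [] , ·-identityʳ (g i)
  Generated⇒evalW one = [] , refl
  Generated⇒evalW {g} (mul x∈ y∈) with Generated⇒evalW x∈ | Generated⇒evalW y∈
  ... | u , refl | v , refl = u ++ v , evalW-++ g u v
  Generated⇒evalW {g} (invG x∈) with Generated⇒evalW x∈
  ... | u , refl = invWord u , evalW-invWord g u

  evalW∈Generated : (g : Fin s → M2) → ∀ w → Generated g (evalW g w)
  evalW∈Generated g [] = one
  evalW∈Generated g ((i , false) ∷ w) = mul (gen i) (evalW∈Generated g w)
  evalW∈Generated g ((i , true) ∷ w) = mul (invG (gen i)) (evalW∈Generated g w)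

  Generated-least : {g : Fin s → M2} {Γ : M2 → Set} → IsSubgroupSL2 Γ → (∀ i → Γ (g i)) →
                    ∀ h → Generated g h → Γ h
  Generated-least Γ≤SL g∈Γ _ (gen i) = g∈Γ i
  Generated-least Γ≤SL g∈Γ _ one = IsSubgroupSL2.one Γ≤SL
  Generated-least Γ≤SL g∈Γ _ (mul x∈ y∈) =
    IsSubgroupSL2.mul Γ≤SL _ _ (Generated-least Γ≤SL g∈Γ _ x∈) (Generated-least Γ≤SL g∈Γ _ y∈)
  Generated-least Γ≤SL g∈Γ _ (invG x∈) = IsSubgroupSL2.invH Γ≤SL _ (Generated-least Γ≤SL g∈Γ _ x∈)

  Generated-isSubgroupSL2 : {g : Fin s → M2} → (∀ i → IsSL2 (g i)) → IsSubgroupSL2 (Generated g)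
  Generated-isSubgroupSL2 {g} g∈SL = record
    { inSL = λ _ → inSL ; one = one ; mul = λ _ _ → mul ; invH = λ _ → invG }
    where
    inSL : ∀ {h} → Generated g h → IsSL2 h
    inSL (gen i) = g∈SL i
    inSL one = refl
    inSL (mul {x} {y} x∈ y∈) = trans (det-· x y) (cong₂ _*_ (inSL x∈) (inSL y∈))
    inSL (invG {x} x∈) = trans (det-inv x) (inSL x∈)

  module _ {t : ℕ} {rel : Fin t → List (Fin s)} (g : Fin s → M2)
           (g∈SL : ∀ i → IsSL2 (g i)) (rel-holds : ∀ j → evalPos g (rel j) ≡ I) where

    evalW-cancel : ∀ i b r → evalW g ((i , b) ∷ (i , not b) ∷ r) ≡ evalW g r
    evalW-cancel i false r = begin
      g i · (inv (g i) · evalW g r)   ≡⟨ sym (·-assoc (g i) (inv (g i)) (evalW g r)) ⟩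
      (g i · inv (g i)) · evalW g r   ≡⟨ cong (_· evalW g r) (inv-inverseʳ (g i) (g∈SL i)) ⟩
      I · evalW g r                   ≡⟨ ·-identityˡ (evalW g r) ⟩
      evalW g r                       ∎
      where open ≡-Reasoning
    evalW-cancel i true r = begin
      inv (g i) · (g i · evalW g r)   ≡⟨ sym (·-assoc (inv (g i)) (g i) (evalW g r)) ⟩
      (inv (g i) · g i) · evalW g r   ≡⟨ cong (_· evalW g r) (inv-inverseˡ (g i) (g∈SL i)) ⟩
      I · evalW g r                   ≡⟨ ·-identityˡ (evalW g r) ⟩
      evalW g r                       ∎
      where open ≡-Reasoning

    evalW-relator : ∀ j r → evalW g (pos (rel j) ++ r) ≡ evalW g r
    evalW-relator j r = begin
      evalW g (pos (rel j) ++ r)         ≡⟨ evalW-++ g (pos (rel j)) r ⟩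
      evalPos g (rel j) · evalW g r      ≡⟨ cong (_· evalW g r) (rel-holds j) ⟩
      I · evalW g r                      ≡⟨ ·-identityˡ (evalW g r) ⟩
      evalW g r                          ∎
      where open ≡-Reasoning

    evalW-++-congˡ : ∀ l {u v} → evalW g u ≡ evalW g v → evalW g (l ++ u) ≡ evalW g (l ++ v)
    evalW-++-congˡ l {u} {v} eq = begin
      evalW g (l ++ u)       ≡⟨ evalW-++ g l u ⟩
      evalW g l · evalW g u  ≡⟨ cong (evalW g l ·_) eq ⟩
      evalW g l · evalW g v  ≡⟨ sym (evalW-++ g l v) ⟩
      evalW g (l ++ v)       ∎
      where open ≡-Reasoning

    evalW-Step : ∀ {u v} → Step rel u v → evalW g u ≡ evalW g v
    evalW-Step (cancel l r i b) = evalW-++-congˡ l (evalW-cancel i b r)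
    evalW-Step (relator l r j) = evalW-++-congˡ l (evalW-relator j r)

    evalW-∼ : ∀ {u v} → u ∼⟨ rel ⟩ v → evalW g u ≡ evalW g v
    evalW-∼ refl∼ = refl
    evalW-∼ (fwd step u∼v) = trans (evalW-Step step) (evalW-∼ u∼v)
    evalW-∼ (bwd step u∼v) = trans (sym (evalW-Step step)) (evalW-∼ u∼v)

sign : Bool → M2 → M2
sign b m = if b then neg m else m

sign-≈P : ∀ b m → sign b m ≈P m
sign-≈P false m = inj₁ refl
sign-≈P true m = inj₂ refl

sign-· : ∀ a b x y → sign a x · sign b y ≡ sign (a xor b) (x · y)
sign-· false false x y = refl
sign-· false true x y = neg-distribʳ-· x y
sign-· true false x y = neg-distribˡ-· x y
sign-· true true x y = neg-·-neg x y

sign-I≡I⇒false : ∀ b → sign b I ≡ I → b ≡ false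
sign-I≡I⇒false false _ = refl
sign-I≡I⇒false true -I≡I = ⊥-elim (I≢neg-I (sym -I≡I))

sign-≢ : ∀ a b m → a ≢ b → sign a m ≡ neg (sign b m)
sign-≢ false false m a≢b = ⊥-elim (a≢b refl)
sign-≢ false true m a≢b = sym (neg-involutive m)
sign-≢ true false m a≢b = refl
sign-≢ true true m a≢b = ⊥-elim (a≢b refl)

sumF2-cong : ∀ {s} {f h : Fin s → Bool} → (∀ k → f k ≡ h k) → sumF2 f ≡ sumF2 h
sumF2-cong {zero} f≗h = refl
sumF2-cong {suc s} f≗h = cong₂ _xor_ (f≗h zero) (sumF2-cong (λ k → f≗h (suc k)))

sumF2-zero : ∀ {s} (f : Fin s → Bool) → (∀ k → f k ≡ false) → sumF2 f ≡ false
sumF2-zero {s} f f≗0 = trans (sumF2-cong f≗0) (sumF2-0 s)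
  where
  sumF2-0 : ∀ s → sumF2 {s} (λ _ → false) ≡ false
  sumF2-0 zero = refl
  sumF2-0 (suc s) = sumF2-0 s

sumF2-xor : ∀ {s} (f h : Fin s → Bool) → sumF2 (λ k → f k xor h k) ≡ sumF2 f xor sumF2 h
sumF2-xor {zero} f h = refl
sumF2-xor {suc s} f h =
  trans (cong ((f zero xor h zero) xor_) (sumF2-xor (λ k → f (suc k)) (λ k → h (suc k))))
        (interchange (f zero) (h zero) _ _)

sumF2-select : ∀ {s} (x : Vec Bool s) (i : Fin s) → sumF2 (λ k → lookup x k ∧ does (i ≟ k)) ≡ lookup x i
sumF2-select (a ∷ x) zero =
  trans (cong₂ _xor_ (∧-identityʳ a) (sumF2-zero _ (λ k → ∧-zeroʳ (lookup x k)))) (xor-identityʳ a)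
sumF2-select (a ∷ x) (suc i) = cong₂ _xor_ (∧-zeroʳ a) (sumF2-select x i)

parity : ∀ {s} → Vec Bool s → List (Fin s) → Bool
parity x w = sumF2 (λ i → lookup x i ∧ mod2 (σ i w))

mod2-σ-∷ : ∀ {s} (k i : Fin s) w → mod2 (σ k (i ∷ w)) ≡ does (i ≟ k) xor mod2 (σ k w)
mod2-σ-∷ k i w with does (i ≟ k)
... | true = refl
... | false = refl

parity-[] : ∀ {s} (x : Vec Bool s) → parity x [] ≡ false
parity-[] x = sumF2-zero _ (λ k → ∧-zeroʳ (lookup x k))

parity-∷ : ∀ {s} (x : Vec Bool s) i w → parity x (i ∷ w) ≡ lookup x i xor parity x w
parity-∷ x i w = begin
  sumF2 (λ k → lookup x k ∧ mod2 (σ k (i ∷ w)))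
    ≡⟨ sumF2-cong (λ k → trans (cong (lookup x k ∧_) (mod2-σ-∷ k i w)) (∧-distribˡ-xor (lookup x k) _ _)) ⟩
  sumF2 (λ k → (lookup x k ∧ does (i ≟ k)) xor (lookup x k ∧ mod2 (σ k w)))
    ≡⟨ sumF2-xor (λ k → lookup x k ∧ does (i ≟ k)) (λ k → lookup x k ∧ mod2 (σ k w)) ⟩
  sumF2 (λ k → lookup x k ∧ does (i ≟ k)) xor parity x w
    ≡⟨ cong (_xor parity x w) (sumF2-select x i) ⟩
  lookup x i xor parity x w
    ∎
  where open ≡-Reasoning

signed : ∀ {s} → (Fin s → M2) → Vec Bool s → Fin s → M2
signed g x i = sign (lookup x i) (g i)

evalPos-signed : ∀ {s} (g : Fin s → M2) (x : Vec Bool s) w →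
                 evalPos (signed g x) w ≡ sign (parity x w) (evalPos g w)
evalPos-signed g x [] = cong (λ b → sign b I) (sym (parity-[] x))
evalPos-signed g x (i ∷ w) = begin
  signed g x i · evalPos (signed g x) w              ≡⟨ cong (signed g x i ·_) (evalPos-signed g x w) ⟩
  sign (lookup x i) (g i) · sign (parity x w) (evalPos g w)
                                                     ≡⟨ sign-· (lookup x i) (parity x w) (g i) (evalPos g w) ⟩
  sign (lookup x i xor parity x w) (evalPos g (i ∷ w)) ≡⟨ cong (λ b → sign b (evalPos g (i ∷ w))) (sym (parity-∷ x i w)) ⟩
  sign (parity x (i ∷ w)) (evalPos g (i ∷ w))        ∎
  where open ≡-Reasoning

module _ {H : M2 → Set} (H≤PSL : IsSubgroupPSL2 H) {s t : ℕ} {gbar : Fin s → M2}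
         {rel : Fin t → List (Fin s)} (pres : IsPresentation H gbar rel) where

  open IsPresentation pres

  H-resp-≈P : ∀ {a b} → a ≈P b → H b → H a
  H-resp-≈P a≈b = IsSubgroupPSL2.resp H≤PSL _ _ (≈P-sym a≈b)

  relators-trivial : ∀ {Γ g} → IsSubgroupSL2 Γ → ¬ Γ (neg I) → (∀ i → Γ (g i)) →
                     (∀ i → g i ≈P gbar i) → ∀ j → evalPos g (rel j) ≡ I
  relators-trivial {Γ} {g} Γ≤SL -I∉Γ g∈Γ g≈gbar j =
    ≈P-I⇒≡I {Γ} -I∉Γ (Generated-least Γ≤SL g∈Γ _ (evalW∈Generated g (pos (rel j))))
                 (≈P-trans (evalW-cong-≈P g≈gbar (pos (rel j))) (relHolds j))

  signs-in-lift : ∀ {Γ g} → IsLift Γ H → (∀ i → H (g i)) → ∃ λ x → ∀ i → Γ (signed g x i)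
  signs-in-lift {Γ} {g} (_ , _ , H⊆±Γ) g∈H = x , signed∈Γ
    where
    choice : ∀ i → ∃ λ b → Γ (sign b (g i))
    choice i with H⊆±Γ (g i) (g∈H i)
    ... | inj₁ gᵢ∈Γ  = false , gᵢ∈Γ
    ... | inj₂ -gᵢ∈Γ = true , -gᵢ∈Γ
    x : Vec Bool s
    x = tabulate (λ i → proj₁ (choice i))
    signed∈Γ : ∀ i → Γ (signed g x i)
    signed∈Γ i = subst (λ b → Γ (sign b (g i))) (sym (lookup∘tabulate _ i)) (proj₂ (choice i))

  module _ {g : Fin s → M2} (g≈gbar : ∀ i → g i ≈P gbar i)
           (rel-holds : ∀ j → evalPos g (rel j) ≡ I) where

    g∈SL : ∀ i → IsSL2 (g i)
    g∈SL i = IsSL2-resp-≈P (g≈gbar i) (IsSubgroupPSL2.inSL H≤PSL (gbar i) (genIn i))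

    Generated⊆H : ∀ h → Generated g h → H h
    Generated⊆H _ (gen i) = H-resp-≈P (g≈gbar i) (genIn i)
    Generated⊆H _ one = IsSubgroupPSL2.one H≤PSL
    Generated⊆H _ (mul x∈ y∈) = IsSubgroupPSL2.mul H≤PSL _ _ (Generated⊆H _ x∈) (Generated⊆H _ y∈)
    Generated⊆H _ (invG x∈) = IsSubgroupPSL2.invH H≤PSL _ (Generated⊆H _ x∈)

    H⊆±Generated : ∀ h → H h → Generated g h ⊎ Generated g (neg h)
    H⊆±Generated h h∈H with surj h h∈H
    ... | w , w≈h with ≈P-trans (evalW-cong-≈P g≈gbar w) w≈h
    ... | inj₁ refl = inj₁ (evalW∈Generated g w)
    ... | inj₂ eq   = inj₂ (subst (Generated g) eq (evalW∈Generated g w))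

    -- A word with value −1 is trivial in PSL₂(ℤ), hence a consequence of the
    -- relations, which hold exactly for g.
    neg-I∉Generated : ¬ Generated g (neg I)
    neg-I∉Generated -I∈ with Generated⇒evalW -I∈
    ... | w , w≡-I = I≢neg-I (trans (sym (evalW-∼ g g∈SL rel-holds w∼[])) w≡-I)
      where
      w∼[] : w ∼⟨ rel ⟩ []
      w∼[] = kernel w (≈P-trans (≈P-sym (evalW-cong-≈P g≈gbar w)) (subst (_≈P I) (sym w≡-I) (inj₂ refl)))

    Generated-isLift : IsLift (Generated g) H × ¬ Generated g (neg I)
    Generated-isLift = (Generated-isSubgroupSL2 g∈SL , Generated⊆H , H⊆±Generated) , neg-I∉Generated

  lift⇒exact-generator-lifts : (Σ (M2 → Set) λ Γ → IsLift Γ H × ¬ Γ (neg I)) →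
    Σ (Fin s → M2) λ g → (∀ i → g i ≈P gbar i) × (∀ j → evalPos g (rel j) ≡ I)
  lift⇒exact-generator-lifts (Γ , Γ-lift@(Γ≤SL , _ , _) , -I∉Γ) with signs-in-lift Γ-lift genIn
  ... | x , signed∈Γ = signed gbar x , signed≈gbar , relators-trivial Γ≤SL -I∉Γ signed∈Γ signed≈gbar
    where
    signed≈gbar : ∀ i → signed gbar x i ≈P gbar i
    signed≈gbar i = sign-≈P (lookup x i) (gbar i)

  exact-generator-lifts⇒lift : (Σ (Fin s → M2) λ g → (∀ i → g i ≈P gbar i) × (∀ j → evalPos g (rel j) ≡ I)) →
    Σ (M2 → Set) λ Γ → IsLift Γ H × ¬ Γ (neg I)
  exact-generator-lifts⇒lift (g , g≈gbar , rel-holds) = Generated g , Generated-isLift g≈gbar rel-holds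

  module _ {g : Fin s → M2} (g≈gbar : ∀ i → g i ≈P gbar i)
           (rel-holds : ∀ j → evalPos g (rel j) ≡ I) where

    signed≈gbar : ∀ x i → signed g x i ≈P gbar i
    signed≈gbar x i = ≈P-trans (sign-≈P (lookup x i) (g i)) (g≈gbar i)

    signed-rel-holds : ∀ x → IsSolution rel x → ∀ j → evalPos (signed g x) (rel j) ≡ I
    signed-rel-holds x x-sol j = begin
      evalPos (signed g x) (rel j)                   ≡⟨ evalPos-signed g x (rel j) ⟩
      sign (parity x (rel j)) (evalPos g (rel j))    ≡⟨ cong₂ sign (x-sol j) (rel-holds j) ⟩
      I                                              ∎
      where open ≡-Reasoning

    ΓX-isLift : (x : Vec Bool s) → IsSolution rel x → IsLift (ΓX g x) H × ¬ ΓX g x (neg I)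
    ΓX-isLift x x-sol = Generated-isLift (signed≈gbar x) (signed-rel-holds x x-sol)

    ΓX-injective : (x y : Vec Bool s) → IsSolution rel x → IsSolution rel y →
                   ΓX g x ≐ ΓX g y → x ≡ y
    ΓX-injective x y _ y-sol ΓX≐ΓY =
      trans (sym (tabulate∘lookup x)) (trans (tabulate-cong xᵢ≡yᵢ) (tabulate∘lookup y))
      where
      ΓY-lift : IsLift (ΓX g y) H × ¬ ΓX g y (neg I)
      ΓY-lift = ΓX-isLift y y-sol
      xᵢ≡yᵢ : ∀ i → lookup x i ≡ lookup y i
      xᵢ≡yᵢ i with lookup x i ≟ᵇ lookup y i
      ... | yes xᵢ≡yᵢ = xᵢ≡yᵢ
      ... | no  xᵢ≢yᵢ = ⊥-elim (proj₂ ΓY-lift (±∈⇒neg-I∈ (proj₁ (proj₁ ΓY-lift)) (gen i) -yᵢ∈ΓY))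
        where
        -yᵢ∈ΓY : ΓX g y (neg (signed g y i))
        -yᵢ∈ΓY = subst (ΓX g y) (sign-≢ _ _ (g i) xᵢ≢yᵢ) (proj₁ (ΓX≐ΓY _) (gen i))

    ΓX-surjective : (Γ : M2 → Set) → IsLift Γ H → ¬ Γ (neg I) →
                    Σ (Vec Bool s) λ x → IsSolution rel x × (Γ ≐ ΓX g x)
    ΓX-surjective Γ Γ-lift@(Γ≤SL , Γ⊆H , _) -I∉Γ
      with signs-in-lift Γ-lift (λ i → H-resp-≈P (g≈gbar i) (genIn i))
    ... | x , signed∈Γ = x , x-sol , lift-⊆⇒≐ Γ≤SL -I∉Γ Γ⊆H (H⊆±Generated (signed≈gbar x) signed-rel)
                                       (Generated-least Γ≤SL signed∈Γ)
      where
      signed-rel : ∀ j → evalPos (signed g x) (rel j) ≡ I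
      signed-rel = relators-trivial Γ≤SL -I∉Γ signed∈Γ (signed≈gbar x)
      x-sol : IsSolution rel x
      x-sol j = sign-I≡I⇒false (parity x (rel j)) (begin
        sign (parity x (rel j)) I                     ≡⟨ cong (sign _) (sym (rel-holds j)) ⟩
        sign (parity x (rel j)) (evalPos g (rel j))   ≡⟨ sym (evalPos-signed g x (rel j)) ⟩
        evalPos (signed g x) (rel j)                  ≡⟨ signed-rel j ⟩
        I                                             ∎)
        where open ≡-Reasoning

-- The finite-index hypothesis is not needed.
lemma2p1 : (H : M2 → Set) → IsSubgroupPSL2 H → FiniteIndex H →
    (s t : ℕ) (gbar : Fin s → M2) (rel : Fin t → List (Fin s)) →
    IsPresentation H gbar rel →
    -- (i)
    (((Σ (M2 → Set) λ Γ → IsLift Γ H × ¬ Γ (neg I)) →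
        Σ (Fin s → M2) λ g → (∀ i → g i ≈P gbar i) × (∀ j → evalPos g (rel j) ≡ I))
     × ((Σ (Fin s → M2) λ g → (∀ i → g i ≈P gbar i) × (∀ j → evalPos g (rel j) ≡ I)) →
        Σ (M2 → Set) λ Γ → IsLift Γ H × ¬ Γ (neg I)))
    ×
    -- (ii)
    ((g : Fin s → M2) → (∀ i → g i ≈P gbar i) → (∀ j → evalPos g (rel j) ≡ I) →
      IsLift (Generated g) H → ¬ Generated g (neg I) →
      ((x : Vec Bool s) → IsSolution rel x → IsLift (ΓX g x) H × ¬ ΓX g x (neg I))
      × ((x y : Vec Bool s) → IsSolution rel x → IsSolution rel y →
          ΓX g x ≐ ΓX g y → x ≡ y)
      × ((Γ : M2 → Set) → IsLift Γ H → ¬ Γ (neg I) →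
          Σ (Vec Bool s) λ x → IsSolution rel x × (Γ ≐ ΓX g x)))
lemma2p1 H H≤PSL _ s t gbar rel pres =
  ( lift⇒exact-generator-lifts H≤PSL pres
  , exact-generator-lifts⇒lift H≤PSL pres )
  , λ g g≈gbar rel-holds _ _ →
      ( ΓX-isLift H≤PSL pres g≈gbar rel-holds
      , ΓX-injective H≤PSL pres g≈gbar rel-holds
      , ΓX-surjective H≤PSL pres g≈gbar rel-holds )
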